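{- Let $\ell \geq 0$ be an integer. Define $$a_t = 2^{2t+1}\binom{\ell+t+1}{2t+1} \quad (0 \leq t \leq \ell), \qquad b_0 = 1, \quad b_t = 2^{2t-1}\binom{\ell+t}{2t-1}\,\frac{\ell+1}{t} \quad (1 \leq t \leq \ell+1),$$ and for $0 \leq t \leq 2\ell+2$ define $c_t$ by: $c_0 = 1$; $$c_t = \frac{2^{3t-1}}{(2t)!}\,\frac{(\ell+\frac{t}{2})!}{(\ell-\frac{t}{2}+1)!}\,\frac{(2\ell+t+1)!!}{(2\ell-t+1)!!}\,(\ell+1) \quad \text{for even } t \text{ with } 2 \leq t \leq \ell;$$ $$c_t = \frac{2^{3t}}{(2t)!}\,\frac{(\ell+\frac{t+1}{2})!}{(\ell-\frac{t-1}{2})!}\,\frac{(2\ell+t)!!}{(2\ell-t+2)!!}\,(\ell+1) \quad \text{for odd } t \text{ with } 1 \leq t \leq \ell;$$ $$c_t = 2^{2t}\,\frac{(2\ell+t+1)!}{(2t)!\,(2\ell+2-t)!}\,(\ell+1) \quad \text{for } \ell+1 \leq t \leq 2\ell+2.$$ Let $A(k) = \sum_{t=0}^{\ell} a_t k^t$, $B(k) = \sum_{t=0}^{\ell+1} b_t k^t$, $C(k) = \sum_{t=0}^{2\ell+2} c_t k^t$. Then all $a_t, b_t, c_t$ are strictly positive integers, and the polynomial identities $$k(k+1)\,A(k)^2 + 1 = B(k)^2 = C(k)$$ hold.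
   Context: For an odd positive integer $N$, $N!!$ denotes the product of all odd integers from $1$ to $N$. -}

module Defs where

open import Data.Nat as ℕ using (ℕ; zero; suc; _∸_; _!; _≤ᵇ_; _%_; _/_)
open import Data.Nat.Combinatorics using (_C_)
open import Data.Bool using (if_then_else_)
open import Data.Integer using (+_)
open import Data.Rational using (ℚ; 0ℚ; 1ℚ; _+_; _*_)
import Data.Rational as ℚ

_!! : ℕ → ℕ
zero !! = 1
suc zero !! = 1
suc (suc n) !! = suc (suc n) ℕ.* (n !!)

-- the rational number n / d (d is always positive where used; d = 0 gives 0)
frac : ℕ → ℕ → ℚ
frac n zero = 0ℚ
frac n (suc d) = (+ n) ℚ./ suc d

ℕtoℚ : ℕ → ℚ
ℕtoℚ n = frac n 1

pow : ℚ → ℕ → ℚ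
pow q zero = 1ℚ
pow q (suc n) = q * pow q n

Σ≤ : ℕ → (ℕ → ℚ) → ℚ
Σ≤ zero f = f 0
Σ≤ (suc n) f = Σ≤ n f + f (suc n)

evalPoly : ℕ → (ℕ → ℚ) → ℚ → ℚ
evalPoly n f k = Σ≤ n (λ t → f t * pow k t)

a : ℕ → ℕ → ℚ
a ℓ t = ℕtoℚ (2 ℕ.^ (2 ℕ.* t ℕ.+ 1) ℕ.* ((ℓ ℕ.+ t ℕ.+ 1) C (2 ℕ.* t ℕ.+ 1)))

b : ℕ → ℕ → ℚ
b ℓ zero = 1ℚ
b ℓ (suc s) = frac (2 ℕ.^ (2 ℕ.* t ∸ 1) ℕ.* ((ℓ ℕ.+ t) C (2 ℕ.* t ∸ 1)) ℕ.* (ℓ ℕ.+ 1)) t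
  where t = suc s

cEven : ℕ → ℕ → ℚ
cEven ℓ s = frac (2 ℕ.^ (3 ℕ.* t ∸ 1) ℕ.* (ℓ ℕ.+ s) ! ℕ.* (2 ℕ.* ℓ ℕ.+ t ℕ.+ 1) !! ℕ.* (ℓ ℕ.+ 1))
                 ((2 ℕ.* t) ! ℕ.* (ℓ ∸ s ℕ.+ 1) ! ℕ.* (2 ℕ.* ℓ ∸ t ℕ.+ 1) !!)
  where t = 2 ℕ.* s

cOdd : ℕ → ℕ → ℚ
cOdd ℓ s = frac (2 ℕ.^ (3 ℕ.* t) ℕ.* (ℓ ℕ.+ (s ℕ.+ 1)) ! ℕ.* (2 ℕ.* ℓ ℕ.+ t) !! ℕ.* (ℓ ℕ.+ 1))
                ((2 ℕ.* t) ! ℕ.* (ℓ ∸ s) ! ℕ.* (2 ℕ.* ℓ ∸ t ℕ.+ 2) !!)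
  where t = 2 ℕ.* s ℕ.+ 1

cBig : ℕ → ℕ → ℚ
cBig ℓ t = frac (2 ℕ.^ (2 ℕ.* t) ℕ.* (2 ℕ.* ℓ ℕ.+ t ℕ.+ 1) ! ℕ.* (ℓ ℕ.+ 1))
                ((2 ℕ.* t) ! ℕ.* (2 ℕ.* ℓ ℕ.+ 2 ∸ t) !)

c : ℕ → ℕ → ℚ
c ℓ zero = 1ℚ
c ℓ (suc s) =
  if t ≤ᵇ ℓ
  then (if t % 2 ℕ.≡ᵇ 0 then cEven ℓ (t / 2) else cOdd ℓ (t / 2))
  else cBig ℓ t
  where t = suc s

A B C : ℕ → ℚ → ℚ
A ℓ = evalPoly ℓ (a ℓ)
B ℓ = evalPoly (suc ℓ) (b ℓ)
C ℓ = evalPoly (2 ℕ.* ℓ ℕ.+ 2) (c ℓ)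

IsPosInt : ℚ → Set
IsPosInt q = Data.Product.Σ ℕ (λ n → (0 ℕ.< n) Data.Product.× (q ≡ ℕtoℚ n))
  where open import Data.Product
        open import Relation.Binary.PropositionalEquality using (_≡_)

{-# OPTIONS --safe #-}
-- Let x = 2k + 1 and D = x² − 1 = 4k(k + 1), and write (x + √D)ⁿ = Xₙ + Yₙ√D, so that
-- Xₙ² − D Yₙ² = 1 and X₂ₙ = 2Xₙ² − 1. By Pascal's rule the binomial sums
-- G_ℓ(k) = Σ 4ᵗ C(ℓ+t, 2t) kᵗ and H_ℓ(k) = Σ 4ᵗ C(ℓ+t+1, 2t+1) kᵗ satisfy the recursions of
-- X_{ℓ+1} − 2kY_{ℓ+1} and Y_{ℓ+1}. Now A = 2H_ℓ, and the absorption identity for binomial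
-- coefficients gives B = G_ℓ + 2kH_ℓ = X_{ℓ+1}; hence k(k+1)A² + 1 = D Y_{ℓ+1}² + 1 = B².
-- For t ≥ 1 the three formulas for c_t agree (by (2n+1)! = 2ⁿ n! (2n+1)!!) and c_t is half the
-- t-th coefficient of B with 2ℓ + 1 in place of ℓ, so C = (1 + X_{2ℓ+2})/2 = X_{ℓ+1}² = B².
module Submission where

open import Defs
open import Data.Nat using (ℕ; _≤_; _+_; _*_)
open import Data.Product using (_×_)
open import Data.Rational using (ℚ; 1ℚ)
import Data.Rational as Q
open import Relation.Binary.PropositionalEquality using (_≡_)

open import Data.Bool using (true; false; if_then_else_; T)
import Data.Integer as ℤ
import Data.Integer.Properties as ℤ
open import Data.Nat as ℕ using (zero; suc; _∸_; _^_; _!; _%_; _/_; _<_; z≤n; s≤s; z<s; NonZero)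
import Data.Nat.Properties as ℕ
open import Data.Nat.Combinatorics
  using (nCk+nC[k+1]≡[n+1]C[k+1]; nCk≡n!/k![n-k]!; k![n∸k]!∣n!; k>n⇒nCk≡0; nC1≡n)
  renaming (_C_ to _choose_)
import Data.Nat.Coprimality as Coprime
open import Data.Nat.DivMod using (m*[n/m]≡n; m%n<n; m≡m%n+[m/n]*n)
open import Data.Nat.Tactic.RingSolver using (solve-∀)
open import Data.Product using (_,_)
open import Data.Rational using (0ℚ; ½; mkℚ)
import Data.Rational.Properties as ℚ
open import Data.Rational.Unnormalised using (mkℚᵘ; *≡*)
open import Data.Unit using (tt)
open import Function using (_∘_)
open import Level using (0ℓ)
open import Relation.Binary.PropositionalEquality using (refl; sym; trans; cong; cong₂; subst; module ≡-Reasoning)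
open import Relation.Nullary.Decidable using (dec⇒maybe)
import Tactic.RingSolver as RingSolver
open import Tactic.RingSolver.Core.AlmostCommutativeRing using (AlmostCommutativeRing; fromCommutativeRing)
open ≡-Reasoning

ℚ-ring : AlmostCommutativeRing 0ℓ 0ℓ
ℚ-ring = fromCommutativeRing ℚ.+-*-commutativeRing (λ x → dec⇒maybe (0ℚ ℚ.≟ x))

ℕtoℚ≡mkℚ : ∀ n → ℕtoℚ n ≡ mkℚ (ℤ.+ n) 0 (Coprime.sym (Coprime.1-coprimeTo n))
ℕtoℚ≡mkℚ n = ℚ.↥p/↧p≡p (mkℚ (ℤ.+ n) 0 (Coprime.sym (Coprime.1-coprimeTo n)))

ℕtoℚ-+ : ∀ m n → ℕtoℚ (m + n) ≡ ℕtoℚ m Q.+ ℕtoℚ n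
ℕtoℚ-+ m n = begin
  ℕtoℚ (m + n)
    ≡⟨ ℚ./-cong {p₁ = ℤ.+ (m + n)} {q₁ = 1}
                (sym (cong₂ ℤ._+_ (ℤ.*-identityʳ (ℤ.+ m)) (ℤ.*-identityʳ (ℤ.+ n)))) refl ⟩
  _ ≡⟨ cong₂ Q._+_ (ℕtoℚ≡mkℚ m) (ℕtoℚ≡mkℚ n) ⟨
  ℕtoℚ m Q.+ ℕtoℚ n ∎

ℕtoℚ-* : ∀ m n → ℕtoℚ (m * n) ≡ ℕtoℚ m Q.* ℕtoℚ n
ℕtoℚ-* m n = begin
  ℕtoℚ (m * n) ≡⟨ ℚ./-cong {p₁ = ℤ.+ (m * n)} {q₁ = 1} (ℤ.pos-* m n) refl ⟩
  _            ≡⟨ cong₂ Q._*_ (ℕtoℚ≡mkℚ m) (ℕtoℚ≡mkℚ n) ⟨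
  ℕtoℚ m Q.* ℕtoℚ n ∎

frac-cross : ∀ {n d n′ d′} → n * suc d′ ≡ n′ * suc d → frac n (suc d) ≡ frac n′ (suc d′)
frac-cross {n} {d} {n′} {d′} eq =
  ℚ.fromℚᵘ-cong {mkℚᵘ (ℤ.+ n) d} {mkℚᵘ (ℤ.+ n′) d′} (*≡* (begin
  (ℤ.+ n) ℤ.* (ℤ.+ suc d′)  ≡⟨ ℤ.pos-* n (suc d′) ⟨
  ℤ.+ (n * suc d′)          ≡⟨ cong ℤ.+_ eq ⟩
  ℤ.+ (n′ * suc d)          ≡⟨ ℤ.pos-* n′ (suc d) ⟩
  (ℤ.+ n′) ℤ.* (ℤ.+ suc d)  ∎))

frac-cancelˡ : ∀ m n d → .{{NonZero m}} → frac (m * n) (m * d) ≡ frac n d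
frac-cancelˡ m n zero rewrite ℕ.*-zeroʳ m = refl
frac-cancelˡ m@(suc m-1) n d@(suc d-1) =
  frac-cross {m * n} {d-1 + m-1 * d} {n} {d-1} (swap m n d)
  where
  swap : ∀ m n d → m * n * d ≡ n * (m * d)
  swap = solve-∀

frac-integral : ∀ {n d m} → .{{NonZero d}} → n ≡ d * m → frac n d ≡ ℕtoℚ m
frac-integral {n} {d@(suc d-1)} {m} eq =
  frac-cross {n} {d-1} {m} {0} (trans (ℕ.*-identityʳ n) (trans eq (ℕ.*-comm d m)))

2*-injective : ∀ {p q} → ℕtoℚ 2 Q.* p ≡ ℕtoℚ 2 Q.* q → p ≡ q
2*-injective {p} {q} 2p≡2q = begin
  p                        ≡⟨ halve p ⟩
  ½ Q.* (ℕtoℚ 2 Q.* p)     ≡⟨ cong (½ Q.*_) 2p≡2q ⟩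
  ½ Q.* (ℕtoℚ 2 Q.* q)     ≡⟨ halve q ⟨
  q                        ∎
  where
  halve : ∀ p → p ≡ ½ Q.* (ℕtoℚ 2 Q.* p)
  halve = RingSolver.solve-∀ ℚ-ring

ℕtoℚ-+* : ∀ x c y → ℕtoℚ (x + c * y) ≡ ℕtoℚ x Q.+ ℕtoℚ c Q.* ℕtoℚ y
ℕtoℚ-+* x c y = trans (ℕtoℚ-+ x (c * y)) (cong (ℕtoℚ x Q.+_) (ℕtoℚ-* c y))

shift : (ℕ → ℚ) → ℕ → ℚ
shift f zero    = 0ℚ
shift f (suc t) = f t

δ₀ : ℕ → ℚ
δ₀ zero    = 1ℚ
δ₀ (suc _) = 0ℚ

evalPoly-cong : ∀ n {f g} k → (∀ t → t ≤ n → f t ≡ g t) → evalPoly n f k ≡ evalPoly n g k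
evalPoly-cong zero    k f≗g = cong (Q._* pow k 0) (f≗g 0 z≤n)
evalPoly-cong (suc n) k f≗g = cong₂ Q._+_
  (evalPoly-cong n k (λ t t≤n → f≗g t (ℕ.m≤n⇒m≤1+n t≤n)))
  (cong (Q._* pow k (suc n)) (f≗g (suc n) ℕ.≤-refl))

evalPoly-+ : ∀ n f g k → evalPoly n (λ t → f t Q.+ g t) k ≡ evalPoly n f k Q.+ evalPoly n g k
evalPoly-+ zero    f g k = ℚ.*-distribʳ-+ (pow k 0) (f 0) (g 0)
evalPoly-+ (suc n) f g k = begin
  evalPoly n (λ t → f t Q.+ g t) k Q.+ (f (suc n) Q.+ g (suc n)) Q.* pow k (suc n)
    ≡⟨ cong₂ Q._+_ (evalPoly-+ n f g k) refl ⟩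
  (evalPoly n f k Q.+ evalPoly n g k) Q.+ (f (suc n) Q.+ g (suc n)) Q.* pow k (suc n)
    ≡⟨ regroup (evalPoly n f k) (evalPoly n g k) (f (suc n)) (g (suc n)) (pow k (suc n)) ⟩
  evalPoly (suc n) f k Q.+ evalPoly (suc n) g k ∎
  where
  regroup : ∀ P R a b p → (P Q.+ R) Q.+ (a Q.+ b) Q.* p ≡ (P Q.+ a Q.* p) Q.+ (R Q.+ b Q.* p)
  regroup = RingSolver.solve-∀ ℚ-ring

evalPoly-*ˡ : ∀ n q f k → evalPoly n (λ t → q Q.* f t) k ≡ q Q.* evalPoly n f k
evalPoly-*ˡ zero    q f k = ℚ.*-assoc q (f 0) 1ℚ
evalPoly-*ˡ (suc n) q f k = begin
  evalPoly n (λ t → q Q.* f t) k Q.+ (q Q.* f (suc n)) Q.* pow k (suc n)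
    ≡⟨ cong₂ Q._+_ (evalPoly-*ˡ n q f k) (ℚ.*-assoc q (f (suc n)) (pow k (suc n))) ⟩
  q Q.* evalPoly n f k Q.+ q Q.* (f (suc n) Q.* pow k (suc n))
    ≡⟨ ℚ.*-distribˡ-+ q (evalPoly n f k) (f (suc n) Q.* pow k (suc n)) ⟨
  q Q.* evalPoly (suc n) f k ∎

evalPoly-shift : ∀ n f k → evalPoly (suc n) (shift f) k ≡ k Q.* evalPoly n f k
evalPoly-shift zero    f k = base (f 0) k
  where
  base : ∀ a k → 0ℚ Q.* 1ℚ Q.+ a Q.* (k Q.* 1ℚ) ≡ k Q.* (a Q.* 1ℚ)
  base = RingSolver.solve-∀ ℚ-ring
evalPoly-shift (suc n) f k = begin
  evalPoly (suc n) (shift f) k Q.+ f (suc n) Q.* (k Q.* pow k (suc n))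
    ≡⟨ cong₂ Q._+_ (evalPoly-shift n f k) refl ⟩
  k Q.* evalPoly n f k Q.+ f (suc n) Q.* (k Q.* pow k (suc n))
    ≡⟨ factor k (evalPoly n f k) (f (suc n)) (pow k (suc n)) ⟩
  k Q.* evalPoly (suc n) f k ∎
  where
  factor : ∀ k P a p → k Q.* P Q.+ a Q.* (k Q.* p) ≡ k Q.* (P Q.+ a Q.* p)
  factor = RingSolver.solve-∀ ℚ-ring

evalPoly-topZero : ∀ n f k → f (suc n) ≡ 0ℚ → evalPoly (suc n) f k ≡ evalPoly n f k
evalPoly-topZero n f k f[1+n]≡0 = begin
  evalPoly n f k Q.+ f (suc n) Q.* pow k (suc n)
    ≡⟨ cong (λ a → evalPoly n f k Q.+ a Q.* pow k (suc n)) f[1+n]≡0 ⟩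
  evalPoly n f k Q.+ 0ℚ Q.* pow k (suc n)
    ≡⟨ cong (evalPoly n f k Q.+_) (ℚ.*-zeroˡ (pow k (suc n))) ⟩
  evalPoly n f k Q.+ 0ℚ
    ≡⟨ ℚ.+-identityʳ (evalPoly n f k) ⟩
  evalPoly n f k ∎

evalPoly-δ₀ : ∀ n k → evalPoly n δ₀ k ≡ 1ℚ
evalPoly-δ₀ zero    k = refl
evalPoly-δ₀ (suc n) k = trans (evalPoly-topZero n δ₀ k refl) (evalPoly-δ₀ n k)

-- X n + Y n √D = (x + √D) ^ n.
module Pell (x : ℚ) where

  D : ℚ
  D = x Q.* x Q.- 1ℚ

  X Y : ℕ → ℚ
  X zero    = 1ℚ
  X (suc n) = x Q.* X n Q.+ D Q.* Y n
  Y zero    = 0ℚ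
  Y (suc n) = X n Q.+ x Q.* Y n

  pell : ∀ n → X n Q.* X n Q.- D Q.* (Y n Q.* Y n) ≡ 1ℚ
  pell zero    = base x
    where
    base : ∀ x → 1ℚ Q.* 1ℚ Q.- (x Q.* x Q.- 1ℚ) Q.* (0ℚ Q.* 0ℚ) ≡ 1ℚ
    base = RingSolver.solve-∀ ℚ-ring
  pell (suc n) = trans (step x (X n) (Y n)) (pell n)
    where
    step : ∀ x p q → let d = x Q.* x Q.- 1ℚ in
      (x Q.* p Q.+ d Q.* q) Q.* (x Q.* p Q.+ d Q.* q) Q.- d Q.* ((p Q.+ x Q.* q) Q.* (p Q.+ x Q.* q))
        ≡ p Q.* p Q.- d Q.* (q Q.* q)
    step = RingSolver.solve-∀ ℚ-ring

  X-+ : ∀ m n → X (m + n) ≡ X m Q.* X n Q.+ D Q.* (Y m Q.* Y n)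
  Y-+ : ∀ m n → Y (m + n) ≡ X m Q.* Y n Q.+ Y m Q.* X n
  X-+ zero    n = base D (X n) (Y n)
    where
    base : ∀ d p q → p ≡ 1ℚ Q.* p Q.+ d Q.* (0ℚ Q.* q)
    base = RingSolver.solve-∀ ℚ-ring
  X-+ (suc m) n = begin
    x Q.* X (m + n) Q.+ D Q.* Y (m + n)
      ≡⟨ cong₂ (λ p q → x Q.* p Q.+ D Q.* q) (X-+ m n) (Y-+ m n) ⟩
    x Q.* (X m Q.* X n Q.+ D Q.* (Y m Q.* Y n)) Q.+ D Q.* (X m Q.* Y n Q.+ Y m Q.* X n)
      ≡⟨ regroup x D (X m) (Y m) (X n) (Y n) ⟩
    X (suc m) Q.* X n Q.+ D Q.* (Y (suc m) Q.* Y n) ∎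
    where
    regroup : ∀ x d p q p′ q′ →
      x Q.* (p Q.* p′ Q.+ d Q.* (q Q.* q′)) Q.+ d Q.* (p Q.* q′ Q.+ q Q.* p′)
        ≡ (x Q.* p Q.+ d Q.* q) Q.* p′ Q.+ d Q.* ((p Q.+ x Q.* q) Q.* q′)
    regroup = RingSolver.solve-∀ ℚ-ring
  Y-+ zero    n = base (X n) (Y n)
    where
    base : ∀ p q → q ≡ 1ℚ Q.* q Q.+ 0ℚ Q.* p
    base = RingSolver.solve-∀ ℚ-ring
  Y-+ (suc m) n = begin
    X (m + n) Q.+ x Q.* Y (m + n)
      ≡⟨ cong₂ (λ p q → p Q.+ x Q.* q) (X-+ m n) (Y-+ m n) ⟩
    (X m Q.* X n Q.+ D Q.* (Y m Q.* Y n)) Q.+ x Q.* (X m Q.* Y n Q.+ Y m Q.* X n)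
      ≡⟨ regroup x D (X m) (Y m) (X n) (Y n) ⟩
    X (suc m) Q.* Y n Q.+ Y (suc m) Q.* X n ∎
    where
    regroup : ∀ x d p q p′ q′ →
      (p Q.* p′ Q.+ d Q.* (q Q.* q′)) Q.+ x Q.* (p Q.* q′ Q.+ q Q.* p′)
        ≡ (x Q.* p Q.+ d Q.* q) Q.* q′ Q.+ (p Q.+ x Q.* q) Q.* p′
    regroup = RingSolver.solve-∀ ℚ-ring

  X-double : ∀ n → X (n + n) ≡ ℕtoℚ 2 Q.* (X n Q.* X n) Q.- 1ℚ
  X-double n = begin
    X (n + n)
      ≡⟨ X-+ n n ⟩
    X n Q.* X n Q.+ D Q.* (Y n Q.* Y n)
      ≡⟨ rearrange (X n Q.* X n) (D Q.* (Y n Q.* Y n)) ⟩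
    ℕtoℚ 2 Q.* (X n Q.* X n) Q.- (X n Q.* X n Q.- D Q.* (Y n Q.* Y n))
      ≡⟨ cong (λ a → ℕtoℚ 2 Q.* (X n Q.* X n) Q.- a) (pell n) ⟩
    ℕtoℚ 2 Q.* (X n Q.* X n) Q.- 1ℚ ∎
    where
    rearrange : ∀ a b → a Q.+ b ≡ ℕtoℚ 2 Q.* a Q.- (a Q.- b)
    rearrange = RingSolver.solve-∀ ℚ-ring

*-pos : ∀ {m n} → 0 < m → 0 < n → 0 < m * n
*-pos {suc _} {suc _} _ _ = z<s

m≡n+o⇒m∸n≡o : ∀ {m n o} → m ≡ n + o → m ∸ n ≡ o
m≡n+o⇒m∸n≡o {n = n} {o} refl = ℕ.m+n∸m≡n n o

2^-rebalance : ∀ {a b c d} f g l → a + b ≡ c + d → 2 ^ a * (2 ^ b * f * g) * l ≡ 2 ^ c * (2 ^ d * f * g * l)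
2^-rebalance {a} {b} {c} {d} f g l a+b≡c+d = begin
  2 ^ a * (2 ^ b * f * g) * l ≡⟨ regroup (2 ^ a) (2 ^ b) f g l ⟩
  2 ^ a * 2 ^ b * (f * g * l) ≡⟨ cong (_* (f * g * l)) (ℕ.^-distribˡ-+-* 2 a b) ⟨
  2 ^ (a + b) * (f * g * l)   ≡⟨ cong (λ e → 2 ^ e * (f * g * l)) a+b≡c+d ⟩
  2 ^ (c + d) * (f * g * l)   ≡⟨ cong (_* (f * g * l)) (ℕ.^-distribˡ-+-* 2 c d) ⟩
  2 ^ c * 2 ^ d * (f * g * l) ≡⟨ regroup′ (2 ^ c) (2 ^ d) f g l ⟩
  2 ^ c * (2 ^ d * f * g * l) ∎
  where
  regroup : ∀ p q f g l → p * (q * f * g) * l ≡ p * q * (f * g * l)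
  regroup = solve-∀
  regroup′ : ∀ p q f g l → p * q * (f * g * l) ≡ p * (q * f * g * l)
  regroup′ = solve-∀

2^[2n]≡4^n : ∀ n → 2 ^ (2 * n) ≡ 4 ^ n
2^[2n]≡4^n n = sym (ℕ.^-*-assoc 2 2 n)

C-pos : ∀ {n k} → k ≤ n → 0 < n choose k
C-pos {k = zero} _ = z<s
C-pos {suc n} {suc k} (s≤s k≤n) =
  subst (0 <_) (nCk+nC[k+1]≡[n+1]C[k+1] n k) (ℕ.<-≤-trans (C-pos k≤n) (ℕ.m≤m+n _ _))

[k+1]*[n+1]C[k+1]≡[n+1]*nCk : ∀ n k → suc k * (suc n choose suc k) ≡ suc n * (n choose k)
[k+1]*[n+1]C[k+1]≡[n+1]*nCk zero    zero    = refl
[k+1]*[n+1]C[k+1]≡[n+1]*nCk zero    (suc k) = ℕ.*-zeroʳ (suc (suc k))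
[k+1]*[n+1]C[k+1]≡[n+1]*nCk (suc n) zero    =
  trans (ℕ.+-identityʳ _) (trans (nC1≡n (suc (suc n))) (sym (ℕ.*-identityʳ _)))
[k+1]*[n+1]C[k+1]≡[n+1]*nCk (suc n) (suc k) = begin
  suc (suc k) * (suc (suc n) choose suc (suc k))
    ≡⟨ cong (suc (suc k) *_) (nCk+nC[k+1]≡[n+1]C[k+1] (suc n) (suc k)) ⟨
  suc (suc k) * (X + Y)
    ≡⟨ regroup k X Y ⟩
  X + (suc k * X + suc (suc k) * Y)
    ≡⟨ cong₂ (λ u v → X + (u + v)) ([k+1]*[n+1]C[k+1]≡[n+1]*nCk n k) ([k+1]*[n+1]C[k+1]≡[n+1]*nCk n (suc k)) ⟩
  X + (suc n * (n choose k) + suc n * (n choose suc k))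
    ≡⟨ cong (X +_) (ℕ.*-distribˡ-+ (suc n) (n choose k) (n choose suc k)) ⟨
  X + suc n * (n choose k + n choose suc k)
    ≡⟨ cong (λ u → X + suc n * u) (nCk+nC[k+1]≡[n+1]C[k+1] n k) ⟩
  suc (suc n) * X ∎
  where
  X = suc n choose suc k
  Y = suc n choose suc (suc k)
  regroup : ∀ k X Y → suc (suc k) * (X + Y) ≡ X + (suc k * X + suc (suc k) * Y)
  regroup = solve-∀

k!*m!*[m+k]Ck≡[m+k]! : ∀ m k → k ! * m ! * ((m + k) choose k) ≡ (m + k) !
k!*m!*[m+k]Ck≡[m+k]! m k = begin
  k ! * m ! * (n choose k)                   ≡⟨ cong (λ j → k ! * j ! * (n choose k)) (ℕ.m+n∸n≡m m k) ⟨
  k ! * (n ∸ k) ! * (n choose k)             ≡⟨ cong (k ! * (n ∸ k) ! *_) (nCk≡n!/k![n-k]! k≤n) ⟩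
  k ! * (n ∸ k) ! * (n ! / (k ! * (n ∸ k) !)) ≡⟨ m*[n/m]≡n (k![n∸k]!∣n! k≤n) ⟩
  n !                                   ∎
  where
  n = m + k
  k≤n = ℕ.m≤n+m k m
  instance _ = k ℕ.!* (n ∸ k) !≢0

[2n]!!≡2^n*n! : ∀ n → (2 * n) !! ≡ 2 ^ n * n !
[2n]!!≡2^n*n! zero    = refl
[2n]!!≡2^n*n! (suc n) = begin
  (2 * suc n) !!              ≡⟨ cong _!! (ℕ.*-suc 2 n) ⟩
  (2 + 2 * n) * (2 * n) !!    ≡⟨ cong ((2 + 2 * n) *_) ([2n]!!≡2^n*n! n) ⟩
  (2 + 2 * n) * (2 ^ n * n !) ≡⟨ regroup n (2 ^ n) (n !) ⟩
  2 * 2 ^ n * (suc n * n !)   ∎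
  where
  regroup : ∀ n p f → (2 + 2 * n) * (p * f) ≡ 2 * p * (suc n * f)
  regroup = solve-∀

[n+1]!!*n!!≡[n+1]! : ∀ n → suc n !! * n !! ≡ suc n !
[n+1]!!*n!!≡[n+1]! zero    = refl
[n+1]!!*n!!≡[n+1]! (suc n) = begin
  suc (suc n) * n !! * suc n !!   ≡⟨ ℕ.*-assoc (suc (suc n)) (n !!) (suc n !!) ⟩
  suc (suc n) * (n !! * suc n !!) ≡⟨ cong (suc (suc n) *_) (ℕ.*-comm (n !!) (suc n !!)) ⟩
  suc (suc n) * (suc n !! * n !!) ≡⟨ cong (suc (suc n) *_) ([n+1]!!*n!!≡[n+1]! n) ⟩
  suc (suc n) * suc n !           ∎

[1+2n]!≡2^n*n!*[1+2n]!! : ∀ n → suc (2 * n) ! ≡ 2 ^ n * n ! * suc (2 * n) !!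
[1+2n]!≡2^n*n!*[1+2n]!! n = begin
  suc (2 * n) !                   ≡⟨ [n+1]!!*n!!≡[n+1]! (2 * n) ⟨
  suc (2 * n) !! * (2 * n) !!     ≡⟨ ℕ.*-comm (suc (2 * n) !!) ((2 * n) !!) ⟩
  (2 * n) !! * suc (2 * n) !!     ≡⟨ cong (_* suc (2 * n) !!) ([2n]!!≡2^n*n! n) ⟩
  2 ^ n * n ! * suc (2 * n) !!    ∎

[2+2n]!≡2^[n+1]*[n+1]!*[1+2n]!! : ∀ n → suc (suc (2 * n)) ! ≡ 2 ^ suc n * suc n ! * suc (2 * n) !!
[2+2n]!≡2^[n+1]*[n+1]!*[1+2n]!! n = begin
  suc (suc (2 * n)) !                   ≡⟨ [n+1]!!*n!!≡[n+1]! (suc (2 * n)) ⟨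
  suc (suc (2 * n)) !! * suc (2 * n) !! ≡⟨ cong (λ m → m !! * suc (2 * n) !!) (ℕ.*-suc 2 n) ⟨
  (2 * suc n) !! * suc (2 * n) !!       ≡⟨ cong (_* suc (2 * n) !!) ([2n]!!≡2^n*n! (suc n)) ⟩
  2 ^ suc n * suc n ! * suc (2 * n) !!  ∎

α γ : ℕ → ℕ → ℕ
α ℓ t = 4 ^ t * ((ℓ + suc t) choose suc (2 * t))
γ ℓ t = 4 ^ t * ((ℓ + t) choose (2 * t))

γ-suc : ∀ ℓ s → γ (suc ℓ) (suc s) ≡ γ ℓ (suc s) + 4 * α ℓ s
γ-suc ℓ s = begin
  4 ^ suc s * (suc N choose (2 * suc s))
    ≡⟨ cong (λ j → 4 ^ suc s * (suc N choose j)) (ℕ.*-suc 2 s) ⟩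
  4 ^ suc s * (suc N choose suc K)
    ≡⟨ cong (4 ^ suc s *_) (nCk+nC[k+1]≡[n+1]C[k+1] N K) ⟨
  4 ^ suc s * (N choose K + N choose suc K)
    ≡⟨ cong (λ j → 4 ^ suc s * (N choose K + N choose j)) (ℕ.*-suc 2 s) ⟨
  4 ^ suc s * (N choose K + N choose (2 * suc s))
    ≡⟨ regroup (4 ^ s) (N choose K) (N choose (2 * suc s)) ⟩
  γ ℓ (suc s) + 4 * α ℓ s ∎
  where
  N = ℓ + suc s
  K = suc (2 * s)
  regroup : ∀ p a b → 4 * p * (a + b) ≡ 4 * p * b + 4 * (p * a)
  regroup = solve-∀

α-suc : ∀ ℓ t → α (suc ℓ) t ≡ α ℓ t + γ (suc ℓ) t
α-suc ℓ t = begin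
  4 ^ t * (suc N choose suc (2 * t))
    ≡⟨ cong (4 ^ t *_) (nCk+nC[k+1]≡[n+1]C[k+1] N (2 * t)) ⟨
  4 ^ t * (N choose (2 * t) + N choose suc (2 * t))
    ≡⟨ ℕ.*-distribˡ-+ (4 ^ t) (N choose (2 * t)) _ ⟩
  4 ^ t * (N choose (2 * t)) + α ℓ t
    ≡⟨ ℕ.+-comm _ (α ℓ t) ⟩
  α ℓ t + 4 ^ t * (N choose (2 * t))
    ≡⟨ cong (λ n → α ℓ t + 4 ^ t * (n choose (2 * t))) (ℕ.+-suc ℓ t) ⟩
  α ℓ t + γ (suc ℓ) t ∎
  where N = ℓ + suc t

γ-top : ∀ ℓ → γ ℓ (suc ℓ) ≡ 0
γ-top ℓ = trans (cong (4 ^ suc ℓ *_) (k>n⇒nCk≡0 (ℕ.≤-reflexive (top ℓ)))) (ℕ.*-zeroʳ (4 ^ suc ℓ))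
  where
  top : ∀ ℓ → suc (ℓ + suc ℓ) ≡ 2 * suc ℓ
  top = solve-∀

α-top : ∀ ℓ → α ℓ (suc ℓ) ≡ 0
α-top ℓ = trans (cong (4 ^ suc ℓ *_) (k>n⇒nCk≡0 (ℕ.≤-reflexive (top ℓ)))) (ℕ.*-zeroʳ (4 ^ suc ℓ))
  where
  top : ∀ ℓ → suc (ℓ + suc (suc ℓ)) ≡ suc (2 * suc ℓ)
  top = solve-∀

α-pos : ∀ {ℓ t} → t ≤ ℓ → 0 < α ℓ t
α-pos {ℓ} {t} t≤ℓ =
  *-pos (ℕ.m^n>0 4 t) (C-pos (subst (_≤ ℓ + suc t) (t+[1+t]≡1+2t t) (ℕ.+-monoˡ-≤ (suc t) t≤ℓ)))
  where
  t+[1+t]≡1+2t : ∀ t → t + suc t ≡ suc (2 * t)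
  t+[1+t]≡1+2t = solve-∀

β : ℕ → ℕ → ℕ
β ℓ zero    = 1
β ℓ (suc s) = γ ℓ (suc s) + 2 * α ℓ s

β-pos : ∀ {ℓ s} → s ≤ ℓ → 0 < β ℓ (suc s)
β-pos {ℓ} {s} s≤ℓ = ℕ.<-≤-trans (*-pos {2} z<s (α-pos s≤ℓ)) (ℕ.m≤n+m _ (γ ℓ (suc s)))

binomial-β-identity : ∀ ℓ s → let N = ℓ + suc s in
  suc ℓ * (N choose suc (2 * s)) ≡ suc s * (2 * (N choose (2 * suc s)) + N choose suc (2 * s))
binomial-β-identity ℓ s = sym (ℕ.+-cancelʳ-≡ (suc s * C₁) _ _ (begin
  suc s * (2 * (N choose (2 * suc s)) + C₁) + suc s * C₁
    ≡⟨ cong (λ j → suc s * (2 * (N choose j) + C₁) + suc s * C₁) (ℕ.*-suc 2 s) ⟩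
  suc s * (2 * C₂ + C₁) + suc s * C₁ ≡⟨ regroup s C₁ C₂ ⟩
  suc K * (C₁ + C₂)                  ≡⟨ cong (suc K *_) (nCk+nC[k+1]≡[n+1]C[k+1] N K) ⟩
  suc K * (suc N choose suc K)       ≡⟨ [k+1]*[n+1]C[k+1]≡[n+1]*nCk N K ⟩
  suc N * C₁                         ≡⟨ split ℓ s C₁ ⟩
  suc ℓ * C₁ + suc s * C₁            ∎))
  where
  N = ℓ + suc s
  K = suc (2 * s)
  C₁ = N choose K
  C₂ = N choose suc K
  regroup : ∀ s a b → suc s * (2 * b + a) + suc s * a ≡ suc (suc (2 * s)) * (a + b)
  regroup = solve-∀
  split : ∀ ℓ s a → suc (ℓ + suc s) * a ≡ suc ℓ * a + suc s * a
  split = solve-∀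

b≡β : ∀ ℓ t → b ℓ t ≡ ℕtoℚ (β ℓ t)
b≡β ℓ zero    = refl
b≡β ℓ (suc s) = frac-integral (begin
  2 ^ (2 * suc s ∸ 1) * (N choose (2 * suc s ∸ 1)) * (ℓ + 1)
    ≡⟨ cong (λ j → 2 ^ j * (N choose j) * (ℓ + 1)) (cong (_∸ 1) (ℕ.*-suc 2 s)) ⟩
  2 * 2 ^ (2 * s) * C₁ * (ℓ + 1)
    ≡⟨ cong (λ p → 2 * p * C₁ * (ℓ + 1)) (2^[2n]≡4^n s) ⟩
  2 * 4 ^ s * C₁ * (ℓ + 1)
    ≡⟨ regroup (4 ^ s) C₁ ℓ ⟩
  2 * 4 ^ s * (suc ℓ * C₁)
    ≡⟨ cong (2 * 4 ^ s *_) (binomial-β-identity ℓ s) ⟩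
  2 * 4 ^ s * (suc s * (2 * C₂ + C₁))
    ≡⟨ distribute (4 ^ s) C₁ C₂ s ⟩
  suc s * β ℓ (suc s) ∎)
  where
  N = ℓ + suc s
  C₁ = N choose suc (2 * s)
  C₂ = N choose (2 * suc s)
  regroup : ∀ p a ℓ → 2 * p * a * (ℓ + 1) ≡ 2 * p * (suc ℓ * a)
  regroup = solve-∀
  distribute : ∀ p a b s → 2 * p * (suc s * (2 * b + a)) ≡ suc s * (4 * p * b + 2 * (p * a))
  distribute = solve-∀

κ : ℕ → ℕ → ℕ
κ ℓ s = 2 * (4 ^ s * ((2 * ℓ + 1 + suc s) choose (2 * suc s))) + α (2 * ℓ + 1) s

2*κ≡β : ∀ ℓ s → 2 * κ ℓ s ≡ β (2 * ℓ + 1) (suc s)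
2*κ≡β ℓ s = distribute (4 ^ s) _ (α (2 * ℓ + 1) s)
  where
  distribute : ∀ p a b → 2 * (2 * (p * a) + b) ≡ 4 * p * a + 2 * b
  distribute = solve-∀

κ-pos : ∀ {ℓ s} → s ≤ 2 * ℓ + 1 → 0 < κ ℓ s
κ-pos s≤ = ℕ.<-≤-trans (α-pos s≤) (ℕ.m≤n+m _ _)

cBig≡κ : ∀ {ℓ s} → s ≤ 2 * ℓ + 1 → cBig ℓ (suc s) ≡ ℕtoℚ (κ ℓ s)
cBig≡κ {ℓ} {s} s≤ with ℕ.m≤n⇒∃[o]m+o≡n s≤
... | m , s+m≡ = frac-integral {{(2 * suc s) ℕ.!* (2 * ℓ + 2 ∸ suc s) !≢0}} (sym (begin
  (2 * suc s) ! * (2 * ℓ + 2 ∸ suc s) ! * κ ℓ s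
    ≡⟨ cong₂ (λ i j → i ! * j ! * κ ℓ s) (ℕ.*-suc 2 s) 2ℓ+2∸[1+s]≡m ⟩
  suc K ! * m ! * κ ℓ s
    ≡⟨ regroup (4 ^ s) (K !) (m !) C₁ C₂ s ⟩
  2 * 4 ^ s * (K ! * m ! * (suc s * (2 * C₂ + C₁)))
    ≡⟨ cong (λ x → 2 * 4 ^ s * (K ! * m ! * x)) (binomial-β-identity (2 * ℓ + 1) s) ⟨
  2 * 4 ^ s * (K ! * m ! * (suc (2 * ℓ + 1) * C₁))
    ≡⟨ regroup′ (4 ^ s) (K ! * m !) C₁ ℓ ⟩
  4 * 4 ^ s * (K ! * m ! * C₁) * (ℓ + 1)
    ≡⟨ cong (λ n → 4 * 4 ^ s * (K ! * m ! * (n choose K)) * (ℓ + 1)) N≡m+K ⟩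
  4 * 4 ^ s * (K ! * m ! * ((m + K) choose K)) * (ℓ + 1)
    ≡⟨ cong (λ x → 4 * 4 ^ s * x * (ℓ + 1)) (k!*m!*[m+k]Ck≡[m+k]! m K) ⟩
  4 * 4 ^ s * (m + K) ! * (ℓ + 1)
    ≡⟨ cong₂ (λ p n → p * n ! * (ℓ + 1)) (2^[2n]≡4^n (suc s)) (trans (reorder ℓ s) N≡m+K) ⟨
  2 ^ (2 * suc s) * (2 * ℓ + suc s + 1) ! * (ℓ + 1) ∎))
  where
  N = 2 * ℓ + 1 + suc s
  K = suc (2 * s)
  C₁ = N choose K
  C₂ = N choose (2 * suc s)
  2ℓ+2∸[1+s]≡m : 2 * ℓ + 2 ∸ suc s ≡ m
  2ℓ+2∸[1+s]≡m = m≡n+o⇒m∸n≡o (trans (ℕ.+-suc (2 * ℓ) 1) (cong suc (sym s+m≡)))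
  N≡m+K : N ≡ m + K
  N≡m+K = trans (cong (_+ suc s) (sym s+m≡)) (shuffle s m)
    where
    shuffle : ∀ s m → s + m + suc s ≡ m + suc (2 * s)
    shuffle = solve-∀
  reorder : ∀ ℓ s → 2 * ℓ + suc s + 1 ≡ 2 * ℓ + 1 + suc s
  reorder = solve-∀
  regroup : ∀ p f g a b s → suc (suc (2 * s)) * f * g * (2 * (p * b) + p * a) ≡ 2 * p * (f * g * (suc s * (2 * b + a)))
  regroup = solve-∀
  regroup′ : ∀ p f a ℓ → 2 * p * (f * (suc (2 * ℓ + 1) * a)) ≡ 4 * p * (f * a) * (ℓ + 1)
  regroup′ = solve-∀

cEven-numerator : ∀ s u → let ℓ = suc s + u ; t = 2 * suc s ; n = ℓ + suc s in
  2 ^ (2 * t) * (2 * ℓ + t + 1) ! * (ℓ + 1) ≡ 2 ^ suc u * (2 ^ (3 * t ∸ 1) * n ! * (2 * ℓ + t + 1) !! * (ℓ + 1))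
cEven-numerator s u = begin
  2 ^ (2 * t) * (2 * ℓ + t + 1) ! * (ℓ + 1)
    ≡⟨ cong (λ j → 2 ^ (2 * t) * j ! * (ℓ + 1)) 2ℓ+t+1≡1+2n ⟩
  2 ^ (2 * t) * suc (2 * n) ! * (ℓ + 1)
    ≡⟨ cong (λ f → 2 ^ (2 * t) * f * (ℓ + 1)) ([1+2n]!≡2^n*n!*[1+2n]!! n) ⟩
  2 ^ (2 * t) * (2 ^ n * n ! * suc (2 * n) !!) * (ℓ + 1)
    ≡⟨ 2^-rebalance {2 * t} {n} {suc u} {3 * t ∸ 1} (n !) (suc (2 * n) !!) (ℓ + 1) exponents ⟩
  2 ^ suc u * (2 ^ (3 * t ∸ 1) * n ! * suc (2 * n) !! * (ℓ + 1))
    ≡⟨ cong (λ j → 2 ^ suc u * (2 ^ (3 * t ∸ 1) * n ! * j !! * (ℓ + 1))) 2ℓ+t+1≡1+2n ⟨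
  2 ^ suc u * (2 ^ (3 * t ∸ 1) * n ! * (2 * ℓ + t + 1) !! * (ℓ + 1)) ∎
  where
  ℓ = suc s + u
  t = 2 * suc s
  n = ℓ + suc s
  2ℓ+t+1≡1+2n : 2 * ℓ + t + 1 ≡ suc (2 * n)
  2ℓ+t+1≡1+2n = shape s u
    where
    shape : ∀ s u → 2 * (suc s + u) + 2 * suc s + 1 ≡ suc (2 * (suc s + u + suc s))
    shape = solve-∀
  exponents : 2 * t + n ≡ suc u + (3 * t ∸ 1)
  exponents = trans (shape s u) (cong (suc u +_) (sym (cong (_∸ 1) (six s))))
    where
    shape : ∀ s u → 2 * (2 * suc s) + (suc s + u + suc s) ≡ suc u + (5 + 6 * s)
    shape = solve-∀
    six : ∀ s → 3 * (2 * suc s) ≡ 6 + 6 * s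
    six = solve-∀

cEven-denominator : ∀ s u → let ℓ = suc s + u ; t = 2 * suc s in
  (2 * t) ! * (2 * ℓ + 2 ∸ t) ! ≡ 2 ^ suc u * ((2 * t) ! * (ℓ ∸ suc s + 1) ! * (2 * ℓ ∸ t + 1) !!)
cEven-denominator s u = begin
  (2 * t) ! * (2 * ℓ + 2 ∸ t) !
    ≡⟨ cong (λ j → (2 * t) ! * j !) (m≡n+o⇒m∸n≡o {2 * ℓ + 2} {t} (shape s u)) ⟩
  (2 * t) ! * suc (suc (2 * u)) !
    ≡⟨ cong ((2 * t) ! *_) ([2+2n]!≡2^[n+1]*[n+1]!*[1+2n]!! u) ⟩
  (2 * t) ! * (2 ^ suc u * suc u ! * suc (2 * u) !!)
    ≡⟨ regroup ((2 * t) !) (2 ^ suc u) (suc u !) (suc (2 * u) !!) ⟩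
  2 ^ suc u * ((2 * t) ! * suc u ! * suc (2 * u) !!)
    ≡⟨ cong₂ (λ i j → 2 ^ suc u * ((2 * t) ! * i ! * j !!)) ℓ∸[1+s]+1≡1+u 2ℓ∸t+1≡1+2u ⟨
  2 ^ suc u * ((2 * t) ! * (ℓ ∸ suc s + 1) ! * (2 * ℓ ∸ t + 1) !!) ∎
  where
  ℓ = suc s + u
  t = 2 * suc s
  shape : ∀ s u → 2 * (suc s + u) + 2 ≡ 2 * suc s + suc (suc (2 * u))
  shape = solve-∀
  regroup : ∀ d p f g → d * (p * f * g) ≡ p * (d * f * g)
  regroup = solve-∀
  ℓ∸[1+s]+1≡1+u : ℓ ∸ suc s + 1 ≡ suc u
  ℓ∸[1+s]+1≡1+u = trans (cong (_+ 1) (ℕ.m+n∸m≡n (suc s) u)) (ℕ.+-comm u 1)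
  2ℓ∸t+1≡1+2u : 2 * ℓ ∸ t + 1 ≡ suc (2 * u)
  2ℓ∸t+1≡1+2u = trans (cong (_+ 1) (m≡n+o⇒m∸n≡o {2 * ℓ} {t} (ℕ.*-distribˡ-+ 2 (suc s) u))) (ℕ.+-comm (2 * u) 1)

cEven≡cBig : ∀ {ℓ s} → suc s ≤ ℓ → cEven ℓ (suc s) ≡ cBig ℓ (2 * suc s)
cEven≡cBig {s = s} 1+s≤ℓ with ℕ.m≤n⇒∃[o]m+o≡n 1+s≤ℓ
... | u , refl = sym (trans (cong₂ frac (cEven-numerator s u) (cEven-denominator s u))
                            (frac-cancelˡ (2 ^ suc u) _ _ {{ℕ.m^n≢0 2 (suc u)}}))

cOdd-numerator : ∀ q w → let ℓ = suc q + w ; t = 2 * q + 1 in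
  2 ^ (2 * t) * (2 * ℓ + t + 1) ! * (ℓ + 1) ≡ 2 ^ suc w * (2 ^ (3 * t) * (ℓ + (q + 1)) ! * (2 * ℓ + t) !! * (ℓ + 1))
cOdd-numerator q w = begin
  2 ^ (2 * t) * (2 * ℓ + t + 1) ! * (ℓ + 1)
    ≡⟨ cong (λ j → 2 ^ (2 * t) * j ! * (ℓ + 1)) (trans (cong (_+ 1) 2ℓ+t≡1+2n) (ℕ.+-comm (suc (2 * n)) 1)) ⟩
  2 ^ (2 * t) * suc (suc (2 * n)) ! * (ℓ + 1)
    ≡⟨ cong (λ f → 2 ^ (2 * t) * f * (ℓ + 1)) ([2+2n]!≡2^[n+1]*[n+1]!*[1+2n]!! n) ⟩
  2 ^ (2 * t) * (2 ^ suc n * suc n ! * suc (2 * n) !!) * (ℓ + 1)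
    ≡⟨ 2^-rebalance {2 * t} {suc n} {suc w} {3 * t} (suc n !) (suc (2 * n) !!) (ℓ + 1) (exponents q w) ⟩
  2 ^ suc w * (2 ^ (3 * t) * suc n ! * suc (2 * n) !! * (ℓ + 1))
    ≡⟨ cong₂ (λ i j → 2 ^ suc w * (2 ^ (3 * t) * i ! * j !! * (ℓ + 1))) (ℓ+[q+1]≡1+n q w) 2ℓ+t≡1+2n ⟨
  2 ^ suc w * (2 ^ (3 * t) * (ℓ + (q + 1)) ! * (2 * ℓ + t) !! * (ℓ + 1)) ∎
  where
  ℓ = suc q + w
  t = 2 * q + 1
  n = ℓ + q
  2ℓ+t≡1+2n : 2 * ℓ + t ≡ suc (2 * n)
  2ℓ+t≡1+2n = shape q w
    where
    shape : ∀ q w → 2 * (suc q + w) + (2 * q + 1) ≡ suc (2 * (suc q + w + q))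
    shape = solve-∀
  exponents : ∀ q w → 2 * (2 * q + 1) + suc (suc q + w + q) ≡ suc w + 3 * (2 * q + 1)
  exponents = solve-∀
  ℓ+[q+1]≡1+n : ∀ q w → suc q + w + (q + 1) ≡ suc (suc q + w + q)
  ℓ+[q+1]≡1+n = solve-∀

cOdd-denominator : ∀ q w → let ℓ = suc q + w ; t = 2 * q + 1 in
  (2 * t) ! * (2 * ℓ + 2 ∸ t) ! ≡ 2 ^ suc w * ((2 * t) ! * (ℓ ∸ q) ! * (2 * ℓ ∸ t + 2) !!)
cOdd-denominator q w = begin
  (2 * t) ! * (2 * ℓ + 2 ∸ t) !
    ≡⟨ cong (λ j → (2 * t) ! * j !) (m≡n+o⇒m∸n≡o {2 * ℓ + 2} {t} (shape q w)) ⟩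
  (2 * t) ! * suc (2 * suc w) !
    ≡⟨ cong ((2 * t) ! *_) ([1+2n]!≡2^n*n!*[1+2n]!! (suc w)) ⟩
  (2 * t) ! * (2 ^ suc w * suc w ! * suc (2 * suc w) !!)
    ≡⟨ regroup ((2 * t) !) (2 ^ suc w) (suc w !) (suc (2 * suc w) !!) ⟩
  2 ^ suc w * ((2 * t) ! * suc w ! * suc (2 * suc w) !!)
    ≡⟨ cong₂ (λ i j → 2 ^ suc w * ((2 * t) ! * i ! * j !!)) ℓ∸q≡1+w 2ℓ∸t+2≡1+2[1+w] ⟨
  2 ^ suc w * ((2 * t) ! * (ℓ ∸ q) ! * (2 * ℓ ∸ t + 2) !!) ∎
  where
  ℓ = suc q + w
  t = 2 * q + 1
  shape : ∀ q w → 2 * (suc q + w) + 2 ≡ (2 * q + 1) + suc (2 * suc w)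
  shape = solve-∀
  shape′ : ∀ q w → 2 * (suc q + w) ≡ (2 * q + 1) + suc (2 * w)
  shape′ = solve-∀
  shape″ : ∀ w → suc (2 * w) + 2 ≡ suc (2 * suc w)
  shape″ = solve-∀
  regroup : ∀ d p f g → d * (p * f * g) ≡ p * (d * f * g)
  regroup = solve-∀
  ℓ∸q≡1+w : ℓ ∸ q ≡ suc w
  ℓ∸q≡1+w = m≡n+o⇒m∸n≡o {ℓ} {q} (sym (ℕ.+-suc q w))
  2ℓ∸t+2≡1+2[1+w] : 2 * ℓ ∸ t + 2 ≡ suc (2 * suc w)
  2ℓ∸t+2≡1+2[1+w] = trans (cong (_+ 2) (m≡n+o⇒m∸n≡o {2 * ℓ} {t} (shape′ q w))) (shape″ w)

cOdd≡cBig : ∀ {ℓ q} → suc q ≤ ℓ → cOdd ℓ q ≡ cBig ℓ (2 * q + 1)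
cOdd≡cBig {q = q} 1+q≤ℓ with ℕ.m≤n⇒∃[o]m+o≡n 1+q≤ℓ
... | w , refl = sym (trans (cong₂ frac (cOdd-numerator q w) (cOdd-denominator q w))
                            (frac-cancelˡ (2 ^ suc w) _ _ {{ℕ.m^n≢0 2 (suc w)}}))

cSmall≡cBig : ∀ {ℓ t} r q → r < 2 → t ≡ r + q * 2 → 0 < t → t ≤ ℓ →
  (if r ℕ.≡ᵇ 0 then cEven ℓ q else cOdd ℓ q) ≡ cBig ℓ t
cSmall≡cBig zero          zero    _ refl () _
cSmall≡cBig {ℓ} zero      (suc q) _ refl _ t≤ℓ =
  trans (cEven≡cBig (ℕ.≤-trans (ℕ.m≤m*n (suc q) 2) t≤ℓ)) (cong (cBig ℓ) (ℕ.*-comm 2 (suc q)))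
cSmall≡cBig {ℓ} (suc zero) q      _ refl _ t≤ℓ =
  trans (cOdd≡cBig (ℕ.≤-trans (s≤s (ℕ.m≤m*n q 2)) t≤ℓ))
        (cong (cBig ℓ) (trans (ℕ.+-comm (2 * q) 1) (cong suc (ℕ.*-comm 2 q))))
cSmall≡cBig (suc (suc _)) _       (s≤s (s≤s ())) _ _ _

c≡cBig : ∀ ℓ s → c ℓ (suc s) ≡ cBig ℓ (suc s)
c≡cBig ℓ s with suc s ℕ.≤ᵇ ℓ in 1+s≤ᵇℓ
... | false = refl
... | true  = cSmall≡cBig (suc s % 2) (suc s / 2) (m%n<n (suc s) 2) (m≡m%n+[m/n]*n (suc s) 2) z<s
                (ℕ.≤ᵇ⇒≤ (suc s) ℓ (subst T (sym 1+s≤ᵇℓ) tt))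

G H : ℕ → ℚ → ℚ
G ℓ = evalPoly ℓ (ℕtoℚ ∘ γ ℓ)
H ℓ = evalPoly ℓ (ℕtoℚ ∘ α ℓ)

evalPoly-γ+shiftα : ∀ ℓ q k →
  evalPoly (suc ℓ) (λ t → ℕtoℚ (γ ℓ t) Q.+ q Q.* shift (ℕtoℚ ∘ α ℓ) t) k ≡ G ℓ k Q.+ q Q.* (k Q.* H ℓ k)
evalPoly-γ+shiftα ℓ q k = begin
  evalPoly (suc ℓ) (λ t → ℕtoℚ (γ ℓ t) Q.+ q Q.* shift (ℕtoℚ ∘ α ℓ) t) k
    ≡⟨ evalPoly-+ (suc ℓ) (ℕtoℚ ∘ γ ℓ) (λ t → q Q.* shift (ℕtoℚ ∘ α ℓ) t) k ⟩
  evalPoly (suc ℓ) (ℕtoℚ ∘ γ ℓ) k Q.+ evalPoly (suc ℓ) (λ t → q Q.* shift (ℕtoℚ ∘ α ℓ) t) k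
    ≡⟨ cong₂ Q._+_ (evalPoly-topZero ℓ (ℕtoℚ ∘ γ ℓ) k (cong ℕtoℚ (γ-top ℓ))) (evalPoly-*ˡ (suc ℓ) q (shift (ℕtoℚ ∘ α ℓ)) k) ⟩
  G ℓ k Q.+ q Q.* evalPoly (suc ℓ) (shift (ℕtoℚ ∘ α ℓ)) k
    ≡⟨ cong (λ p → G ℓ k Q.+ q Q.* p) (evalPoly-shift ℓ (ℕtoℚ ∘ α ℓ) k) ⟩
  G ℓ k Q.+ q Q.* (k Q.* H ℓ k) ∎

G-suc : ∀ ℓ k → G (suc ℓ) k ≡ G ℓ k Q.+ ℕtoℚ 4 Q.* (k Q.* H ℓ k)
G-suc ℓ k = trans (evalPoly-cong (suc ℓ) k (λ t _ → γ-sucℚ t)) (evalPoly-γ+shiftα ℓ (ℕtoℚ 4) k)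
  where
  γ-sucℚ : ∀ t → ℕtoℚ (γ (suc ℓ) t) ≡ ℕtoℚ (γ ℓ t) Q.+ ℕtoℚ 4 Q.* shift (ℕtoℚ ∘ α ℓ) t
  γ-sucℚ zero    = refl
  γ-sucℚ (suc s) = trans (cong ℕtoℚ (γ-suc ℓ s)) (ℕtoℚ-+* (γ ℓ (suc s)) 4 (α ℓ s))

H-suc : ∀ ℓ k → H (suc ℓ) k ≡ H ℓ k Q.+ G (suc ℓ) k
H-suc ℓ k = begin
  evalPoly (suc ℓ) (ℕtoℚ ∘ α (suc ℓ)) k
    ≡⟨ evalPoly-cong (suc ℓ) k (λ t _ → trans (cong ℕtoℚ (α-suc ℓ t)) (ℕtoℚ-+ (α ℓ t) (γ (suc ℓ) t))) ⟩
  evalPoly (suc ℓ) (λ t → ℕtoℚ (α ℓ t) Q.+ ℕtoℚ (γ (suc ℓ) t)) k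
    ≡⟨ evalPoly-+ (suc ℓ) (ℕtoℚ ∘ α ℓ) (ℕtoℚ ∘ γ (suc ℓ)) k ⟩
  evalPoly (suc ℓ) (ℕtoℚ ∘ α ℓ) k Q.+ G (suc ℓ) k
    ≡⟨ cong (Q._+ G (suc ℓ) k) (evalPoly-topZero ℓ (ℕtoℚ ∘ α ℓ) k (cong ℕtoℚ (α-top ℓ))) ⟩
  H ℓ k Q.+ G (suc ℓ) k ∎

a≡2*α : ∀ ℓ t → a ℓ t ≡ ℕtoℚ (2 * α ℓ t)
a≡2*α ℓ t = cong ℕtoℚ (begin
  2 ^ (2 * t + 1) * ((ℓ + t + 1) choose (2 * t + 1))
    ≡⟨ cong₂ (λ n j → 2 ^ j * (n choose j)) (trans (ℕ.+-assoc ℓ t 1) (cong (ℓ +_) (ℕ.+-comm t 1))) (ℕ.+-comm (2 * t) 1) ⟩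
  2 * 2 ^ (2 * t) * X ≡⟨ cong (λ p → 2 * p * X) (2^[2n]≡4^n t) ⟩
  2 * 4 ^ t * X       ≡⟨ ℕ.*-assoc 2 (4 ^ t) X ⟩
  2 * α ℓ t           ∎)
  where X = (ℓ + suc t) choose suc (2 * t)

A≡2*H : ∀ ℓ k → A ℓ k ≡ ℕtoℚ 2 Q.* H ℓ k
A≡2*H ℓ k = trans (evalPoly-cong ℓ k (λ t _ → trans (a≡2*α ℓ t) (ℕtoℚ-* 2 (α ℓ t))))
                  (evalPoly-*ˡ ℓ (ℕtoℚ 2) (ℕtoℚ ∘ α ℓ) k)

B≡G+2*k*H : ∀ ℓ k → B ℓ k ≡ G ℓ k Q.+ ℕtoℚ 2 Q.* (k Q.* H ℓ k)
B≡G+2*k*H ℓ k =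
  trans (evalPoly-cong (suc ℓ) k (λ t _ → trans (b≡β ℓ t) (βℚ t))) (evalPoly-γ+shiftα ℓ (ℕtoℚ 2) k)
  where
  βℚ : ∀ t → ℕtoℚ (β ℓ t) ≡ ℕtoℚ (γ ℓ t) Q.+ ℕtoℚ 2 Q.* shift (ℕtoℚ ∘ α ℓ) t
  βℚ zero    = refl
  βℚ (suc s) = ℕtoℚ-+* (γ ℓ (suc s)) 2 (α ℓ s)

c≡κ : ∀ {ℓ s} → s ≤ 2 * ℓ + 1 → c ℓ (suc s) ≡ ℕtoℚ (κ ℓ s)
c≡κ {ℓ} {s} s≤ = trans (c≡cBig ℓ s) (cBig≡κ s≤)

1+s≤2ℓ+2⇒s≤2ℓ+1 : ∀ ℓ {s} → suc s ≤ 2 * ℓ + 2 → s ≤ 2 * ℓ + 1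
1+s≤2ℓ+2⇒s≤2ℓ+1 ℓ {s} le = ℕ.≤-pred (subst (suc s ≤_) (ℕ.+-suc (2 * ℓ) 1) le)

2*C≡1+B : ∀ ℓ k → ℕtoℚ 2 Q.* C ℓ k ≡ 1ℚ Q.+ B (2 * ℓ + 1) k
2*C≡1+B ℓ k = begin
  ℕtoℚ 2 Q.* evalPoly n (c ℓ) k                   ≡⟨ evalPoly-*ˡ n (ℕtoℚ 2) (c ℓ) k ⟨
  evalPoly n (λ t → ℕtoℚ 2 Q.* c ℓ t) k            ≡⟨ evalPoly-cong n k 2*c≡δ₀+b ⟩
  evalPoly n (λ t → δ₀ t Q.+ b (2 * ℓ + 1) t) k    ≡⟨ evalPoly-+ n δ₀ (b (2 * ℓ + 1)) k ⟩
  evalPoly n δ₀ k Q.+ evalPoly n (b (2 * ℓ + 1)) k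
    ≡⟨ cong₂ Q._+_ (evalPoly-δ₀ n k) (cong (λ m → evalPoly m (b (2 * ℓ + 1)) k) (ℕ.+-suc (2 * ℓ) 1)) ⟩
  1ℚ Q.+ B (2 * ℓ + 1) k                           ∎
  where
  n = 2 * ℓ + 2
  2*c≡δ₀+b : ∀ t → t ≤ n → ℕtoℚ 2 Q.* c ℓ t ≡ δ₀ t Q.+ b (2 * ℓ + 1) t
  2*c≡δ₀+b zero    _  = refl
  2*c≡δ₀+b (suc s) le = begin
    ℕtoℚ 2 Q.* c ℓ (suc s)         ≡⟨ cong (ℕtoℚ 2 Q.*_) (c≡κ {ℓ} (1+s≤2ℓ+2⇒s≤2ℓ+1 ℓ le)) ⟩
    ℕtoℚ 2 Q.* ℕtoℚ (κ ℓ s)        ≡⟨ ℕtoℚ-* 2 (κ ℓ s) ⟨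
    ℕtoℚ (2 * κ ℓ s)               ≡⟨ cong ℕtoℚ (2*κ≡β ℓ s) ⟩
    ℕtoℚ (β (2 * ℓ + 1) (suc s))   ≡⟨ b≡β (2 * ℓ + 1) (suc s) ⟨
    b (2 * ℓ + 1) (suc s)          ≡⟨ ℚ.+-identityˡ _ ⟨
    0ℚ Q.+ b (2 * ℓ + 1) (suc s)   ∎

module _ (k : ℚ) where
  open Pell (ℕtoℚ 2 Q.* k Q.+ 1ℚ)

  H≡Y : ∀ ℓ → H ℓ k ≡ Y (suc ℓ)
  G≡X-2kY : ∀ ℓ → G ℓ k ≡ X (suc ℓ) Q.- ℕtoℚ 2 Q.* k Q.* Y (suc ℓ)
  H≡Y zero = base k
    where
    base : ∀ k → 1ℚ ≡ 1ℚ Q.+ (ℕtoℚ 2 Q.* k Q.+ 1ℚ) Q.* 0ℚ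
    base = RingSolver.solve-∀ ℚ-ring
  H≡Y (suc ℓ) = begin
    H (suc ℓ) k
      ≡⟨ H-suc ℓ k ⟩
    H ℓ k Q.+ G (suc ℓ) k
      ≡⟨ cong₂ Q._+_ (H≡Y ℓ) (G≡X-2kY (suc ℓ)) ⟩
    Y (suc ℓ) Q.+ (X (suc (suc ℓ)) Q.- ℕtoℚ 2 Q.* k Q.* Y (suc (suc ℓ)))
      ≡⟨ step k (X (suc ℓ)) (Y (suc ℓ)) ⟩
    Y (suc (suc ℓ)) ∎
    where
    step : ∀ k p q → let x = ℕtoℚ 2 Q.* k Q.+ 1ℚ in
      q Q.+ ((x Q.* p Q.+ (x Q.* x Q.- 1ℚ) Q.* q) Q.- ℕtoℚ 2 Q.* k Q.* (p Q.+ x Q.* q)) ≡ p Q.+ x Q.* q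
    step = RingSolver.solve-∀ ℚ-ring
  G≡X-2kY zero = base k
    where
    base : ∀ k → let x = ℕtoℚ 2 Q.* k Q.+ 1ℚ in
      1ℚ ≡ (x Q.* 1ℚ Q.+ (x Q.* x Q.- 1ℚ) Q.* 0ℚ) Q.- ℕtoℚ 2 Q.* k Q.* (1ℚ Q.+ x Q.* 0ℚ)
    base = RingSolver.solve-∀ ℚ-ring
  G≡X-2kY (suc ℓ) = begin
    G (suc ℓ) k
      ≡⟨ G-suc ℓ k ⟩
    G ℓ k Q.+ ℕtoℚ 4 Q.* (k Q.* H ℓ k)
      ≡⟨ cong₂ (λ g h → g Q.+ ℕtoℚ 4 Q.* (k Q.* h)) (G≡X-2kY ℓ) (H≡Y ℓ) ⟩
    (X (suc ℓ) Q.- ℕtoℚ 2 Q.* k Q.* Y (suc ℓ)) Q.+ ℕtoℚ 4 Q.* (k Q.* Y (suc ℓ))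
      ≡⟨ step k (X (suc ℓ)) (Y (suc ℓ)) ⟩
    X (suc (suc ℓ)) Q.- ℕtoℚ 2 Q.* k Q.* Y (suc (suc ℓ)) ∎
    where
    step : ∀ k p q → let x = ℕtoℚ 2 Q.* k Q.+ 1ℚ in
      (p Q.- ℕtoℚ 2 Q.* k Q.* q) Q.+ ℕtoℚ 4 Q.* (k Q.* q)
        ≡ (x Q.* p Q.+ (x Q.* x Q.- 1ℚ) Q.* q) Q.- ℕtoℚ 2 Q.* k Q.* (p Q.+ x Q.* q)
    step = RingSolver.solve-∀ ℚ-ring

  B≡X : ∀ ℓ → B ℓ k ≡ X (suc ℓ)
  B≡X ℓ = begin
    B ℓ k                                               ≡⟨ B≡G+2*k*H ℓ k ⟩
    G ℓ k Q.+ ℕtoℚ 2 Q.* (k Q.* H ℓ k)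
      ≡⟨ cong₂ (λ g h → g Q.+ ℕtoℚ 2 Q.* (k Q.* h)) (G≡X-2kY ℓ) (H≡Y ℓ) ⟩
    X (suc ℓ) Q.- ℕtoℚ 2 Q.* k Q.* Y (suc ℓ) Q.+ ℕtoℚ 2 Q.* (k Q.* Y (suc ℓ))
      ≡⟨ cancel k (X (suc ℓ)) (Y (suc ℓ)) ⟩
    X (suc ℓ)                                           ∎
    where
    cancel : ∀ k p q → p Q.- ℕtoℚ 2 Q.* k Q.* q Q.+ ℕtoℚ 2 Q.* (k Q.* q) ≡ p
    cancel = RingSolver.solve-∀ ℚ-ring

  A≡2*Y : ∀ ℓ → A ℓ k ≡ ℕtoℚ 2 Q.* Y (suc ℓ)
  A≡2*Y ℓ = trans (A≡2*H ℓ k) (cong (ℕtoℚ 2 Q.*_) (H≡Y ℓ))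

  k[k+1]A²+1≡B² : ∀ ℓ → k Q.* (k Q.+ 1ℚ) Q.* (A ℓ k Q.* A ℓ k) Q.+ 1ℚ ≡ B ℓ k Q.* B ℓ k
  k[k+1]A²+1≡B² ℓ = begin
    k Q.* (k Q.+ 1ℚ) Q.* (A ℓ k Q.* A ℓ k) Q.+ 1ℚ
      ≡⟨ cong₂ (λ a o → k Q.* (k Q.+ 1ℚ) Q.* (a Q.* a) Q.+ o) (A≡2*Y ℓ) (sym (pell (suc ℓ))) ⟩
    k Q.* (k Q.+ 1ℚ) Q.* ((ℕtoℚ 2 Q.* q) Q.* (ℕtoℚ 2 Q.* q)) Q.+ (p Q.* p Q.- D Q.* (q Q.* q))
      ≡⟨ substitute-D k p q ⟩
    p Q.* p                                        ≡⟨ cong₂ Q._*_ (B≡X ℓ) (B≡X ℓ) ⟨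
    B ℓ k Q.* B ℓ k                                ∎
    where
    p = X (suc ℓ)
    q = Y (suc ℓ)
    substitute-D : ∀ k p q → let x = ℕtoℚ 2 Q.* k Q.+ 1ℚ in
      k Q.* (k Q.+ 1ℚ) Q.* ((ℕtoℚ 2 Q.* q) Q.* (ℕtoℚ 2 Q.* q)) Q.+ (p Q.* p Q.- (x Q.* x Q.- 1ℚ) Q.* (q Q.* q)) ≡ p Q.* p
    substitute-D = RingSolver.solve-∀ ℚ-ring

  B²≡C : ∀ ℓ → B ℓ k Q.* B ℓ k ≡ C ℓ k
  B²≡C ℓ = 2*-injective (begin
    ℕtoℚ 2 Q.* (B ℓ k Q.* B ℓ k)              ≡⟨ cong (λ p → ℕtoℚ 2 Q.* (p Q.* p)) (B≡X ℓ) ⟩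
    ℕtoℚ 2 Q.* (X (suc ℓ) Q.* X (suc ℓ))      ≡⟨ a≡1+[a-1] (ℕtoℚ 2 Q.* (X (suc ℓ) Q.* X (suc ℓ))) ⟩
    1ℚ Q.+ (ℕtoℚ 2 Q.* (X (suc ℓ) Q.* X (suc ℓ)) Q.- 1ℚ) ≡⟨ cong (1ℚ Q.+_) (X-double (suc ℓ)) ⟨
    1ℚ Q.+ X (suc ℓ + suc ℓ)                  ≡⟨ cong (λ n → 1ℚ Q.+ X n) (2ℓ+2≡[ℓ+1]+[ℓ+1] ℓ) ⟨
    1ℚ Q.+ X (suc (2 * ℓ + 1))                ≡⟨ cong (1ℚ Q.+_) (B≡X (2 * ℓ + 1)) ⟨
    1ℚ Q.+ B (2 * ℓ + 1) k                    ≡⟨ 2*C≡1+B ℓ k ⟨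
    ℕtoℚ 2 Q.* C ℓ k                          ∎)
    where
    a≡1+[a-1] : ∀ a → a ≡ 1ℚ Q.+ (a Q.- 1ℚ)
    a≡1+[a-1] = RingSolver.solve-∀ ℚ-ring
    2ℓ+2≡[ℓ+1]+[ℓ+1] : ∀ ℓ → suc (2 * ℓ + 1) ≡ suc ℓ + suc ℓ
    2ℓ+2≡[ℓ+1]+[ℓ+1] = solve-∀

a-isPosInt : ∀ ℓ t → t ≤ ℓ → IsPosInt (a ℓ t)
a-isPosInt ℓ t t≤ℓ = 2 * α ℓ t , *-pos {2} z<s (α-pos t≤ℓ) , a≡2*α ℓ t

b-isPosInt : ∀ ℓ t → t ≤ ℓ + 1 → IsPosInt (b ℓ t)
b-isPosInt ℓ zero    _  = 1 , z<s , refl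
b-isPosInt ℓ (suc s) le =
  β ℓ (suc s) , β-pos (ℕ.≤-pred (subst (suc s ≤_) (ℕ.+-comm ℓ 1) le)) , b≡β ℓ (suc s)

c-isPosInt : ∀ ℓ t → t ≤ 2 * ℓ + 2 → IsPosInt (c ℓ t)
c-isPosInt ℓ zero    _  = 1 , z<s , refl
c-isPosInt ℓ (suc s) le = κ ℓ s , κ-pos {ℓ} s≤2ℓ+1 , c≡κ {ℓ} s≤2ℓ+1
  where s≤2ℓ+1 = 1+s≤2ℓ+2⇒s≤2ℓ+1 ℓ le

mainTheorem8 : (ℓ : ℕ) →
    ((t : ℕ) → t ≤ ℓ → IsPosInt (a ℓ t)) ×
    ((t : ℕ) → t ≤ ℓ + 1 → IsPosInt (b ℓ t)) ×
    ((t : ℕ) → t ≤ 2 * ℓ + 2 → IsPosInt (c ℓ t)) ×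
    ((k : ℚ) →
      (k Q.* (k Q.+ 1ℚ) Q.* (A ℓ k Q.* A ℓ k) Q.+ 1ℚ ≡ B ℓ k Q.* B ℓ k) ×
      (B ℓ k Q.* B ℓ k ≡ C ℓ k))
mainTheorem8 ℓ = a-isPosInt ℓ , b-isPosInt ℓ , c-isPosInt ℓ , λ k → k[k+1]A²+1≡B² k ℓ , B²≡C k ℓ
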